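{- For every positive integer $k$, $S(k+4)\ge 109\,S(k)+39$.
   Context: A set of integers is sum-free if it contains no integers $a,b,c$ (not necessarily distinct) with $a+b=c$. For a positive integer $k$, the Schur number $S(k)$ is the largest $n$ such that the interval $[1,n]=\{1,\dots,n\}$ can be partitioned into $k$ sum-free subsets. -}

module Defs where

open import Data.Nat using (ℕ; _+_; _≤_)
open import Data.Fin using (Fin)
open import Data.Product using (Σ; _×_)
open import Relation.Nullary using (¬_)
open import Relation.Binary.PropositionalEquality using (_≡_)

-- A k-colouring of [1,n] is a partition of [1,n] into k (possibly empty)
-- subsets: the i-th part is { x ∈ [1,n] ∣ c x ≡ i }.  (Values of c outside
-- [1,n] are irrelevant.)
-- A part P is sum-free if there are no a, b, c ∈ P (not necessarily
-- distinct) with a + b = c.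
SumFreePart : (k n : ℕ) → (ℕ → Fin k) → Fin k → Set
SumFreePart k n c i =
  ∀ a b → 1 ≤ a → 1 ≤ b → a + b ≤ n →
  ¬ (c a ≡ i × c b ≡ i × c (a + b) ≡ i)

SumFreePartitionable : ℕ → ℕ → Set
SumFreePartitionable k n = Σ (ℕ → Fin k) λ c → ∀ i → SumFreePart k n c i

IsSchurNumber : ℕ → ℕ → Set
IsSchurNumber k s =
  SumFreePartitionable k s × (∀ n → SumFreePartitionable k n → n ≤ s)

-- Given a sum-free k-colouring c of [1, s], colour x ∈ [1, 109 s + 39] according to x mod 109:
-- the residues in four fixed classes receive four new colours, and every
-- other ("kept") residue keeps the old colour c ⌈x/109⌉.  Each fresh class is sum-free modulo
-- 109, hence sum-free in ℕ.  On kept residues x ↦ ⌈x/109⌉ is additive, so a monochromatic kept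
-- triple would yield one for c; and as the residues 1, …, 39 are all fresh, a kept
-- x ≤ 109 s + 39 has ⌈x/109⌉ ≤ s.  These three properties of the residue pattern are finite
-- and are checked by evaluation.
module Submission where

open import Defs
open import Data.Nat using (ℕ; _+_; _*_; _≤_)
open import Data.Nat
  using (zero; suc; pred; _∸_; _<_; _%_; _/_; NonZero; s≤s⁻¹; _≡ᵇ_; _≤?_; _<?_)
open import Data.Nat.Properties
open import Data.Nat.DivMod
open import Data.Nat.Divisibility using (n∣m*n; m∣m*n)
open import Data.Fin using (Fin; zero; suc; _↑ˡ_; _↑ʳ_; splitAt)
open import Data.Fin.Properties
  using (↑ˡ-injective; ↑ʳ-injective; splitAt-↑ˡ; splitAt-↑ʳ; all?)
  renaming (_≟_ to _≟ᶠ_)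
open import Data.Maybe using (Maybe; just; nothing; maybe′)
import Data.Maybe as Maybe
open import Data.Maybe.Properties using (≡-dec)
open import Data.List using (List; []; _∷_)
open import Data.Bool.ListAction using (any)
open import Data.Vec using (Vec; []; _∷_)
open import Data.Bool using (Bool; true; _∧_; T; if_then_else_)
open import Data.Bool.Properties using (T-∧; T-≡)
open import Function.Bundles using (Equivalence)
open import Data.Unit using (tt)
open import Data.Empty using (⊥-elim)
open import Data.Product using (_,_)
open import Data.Sum using (inj₁; inj₂)
open import Function using (_∘_)
open import Relation.Nullary using (Dec; yes; no)
open import Relation.Nullary.Decidable using (isYes; toWitness; ¬?; _→-dec_)
open import Relation.Binary.PropositionalEquality
open import Algebra.Properties.CommutativeSemigroup +-commutativeSemigroup using (interchange)

allBelow : ℕ → (ℕ → Bool) → Bool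
allBelow zero    f = true
allBelow (suc n) f = f n ∧ allBelow n f

allBelow-sound : ∀ n {f} → T (allBelow n f) → ∀ {r} → r < n → T (f r)
allBelow-sound (suc n) ok r<1+n with Equivalence.to T-∧ ok | m<1+n⇒m<n∨m≡n r<1+n
... | fn , _    | inj₂ refl = fn
... | _  , rest | inj₁ r<n  = allBelow-sound n rest r<n

-- The hypotheses read `≡ true` rather than `T …`: Agda checks `refl` against a large closed
-- Boolean much faster than `tt` against `T` of it.
module _ {P : ℕ → Set} (P? : ∀ r → Dec (P r)) where

  allBelow-decide : ∀ n → allBelow n (isYes ∘ P?) ≡ true → ∀ {r} → r < n → P r
  allBelow-decide n ok r<n = toWitness (allBelow-sound n (Equivalence.from T-≡ ok) r<n)

module _ {Q : ℕ → ℕ → Set} (Q? : ∀ r₁ r₂ → Dec (Q r₁ r₂)) where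

  allBelow²-decide : ∀ n → allBelow n (λ r₁ → allBelow n (isYes ∘ Q? r₁)) ≡ true →
                     ∀ {r₁} → r₁ < n → ∀ {r₂} → r₂ < n → Q r₁ r₂
  allBelow²-decide n ok r₁<n = allBelow-decide (Q? _) n
    (Equivalence.to T-≡ (allBelow-sound n (Equivalence.from T-≡ ok) r₁<n))

⌈_/_⌉ : ℕ → (m : ℕ) .{{_ : NonZero m}} → ℕ
⌈ n / m ⌉ = (n + pred m) / m

module _ (m : ℕ) .{{_ : NonZero m}} where

  ⌈r+q*m/m⌉≡q+⌈r/m⌉ : ∀ r q → ⌈ r + q * m / m ⌉ ≡ q + ⌈ r / m ⌉
  ⌈r+q*m/m⌉≡q+⌈r/m⌉ r q = begin
    (r + q * m + pred m) / m       ≡⟨ /-congˡ (trans (cong (_+ pred m) (+-comm r (q * m)))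
                                                     (+-assoc (q * m) r (pred m))) ⟩
    (q * m + (r + pred m)) / m     ≡⟨ +-distrib-/-∣ˡ (r + pred m) (n∣m*n q) ⟩
    q * m / m + (r + pred m) / m   ≡⟨ cong (_+ ⌈ r / m ⌉) (m*n/n≡m q m) ⟩
    q + ⌈ r / m ⌉                  ∎
    where open ≡-Reasoning

  ⌈n/m⌉≡n/m+⌈n%m/m⌉ : ∀ n → ⌈ n / m ⌉ ≡ n / m + ⌈ n % m / m ⌉
  ⌈n/m⌉≡n/m+⌈n%m/m⌉ n = trans (cong (λ x → ⌈ x / m ⌉) (m≡m%n+[m/n]*n n m))
                                (⌈r+q*m/m⌉≡q+⌈r/m⌉ (n % m) (n / m))

  ⌈n/m⌉>0 : ∀ {n} → 0 < n → 0 < ⌈ n / m ⌉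
  ⌈n/m⌉>0 {n} n>0 = m≥n⇒m/n>0 (subst (_≤ n + pred m) (suc-pred m) (+-monoˡ-≤ (pred m) n>0))

  ⌈n/m⌉≤q : ∀ {n q} → n ≤ m * q → ⌈ n / m ⌉ ≤ q
  ⌈n/m⌉≤q {n} {q} n≤mq = s≤s⁻¹ (m<n*o⇒m/o<n (begin-strict
    n + pred m     ≤⟨ +-monoˡ-≤ (pred m) n≤mq ⟩
    m * q + pred m <⟨ +-monoʳ-< (m * q) (≤-reflexive (suc-pred m)) ⟩
    m * q + m      ≡⟨ trans (+-comm (m * q) m) (cong (m +_) (*-comm m q)) ⟩
    suc q * m      ∎))
    where open ≤-Reasoning

  ⌈/⌉-additive : ∀ a b → ⌈ a % m / m ⌉ + ⌈ b % m / m ⌉ ≡ ⌈ a % m + b % m / m ⌉ →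
                 ⌈ a / m ⌉ + ⌈ b / m ⌉ ≡ ⌈ a + b / m ⌉
  ⌈/⌉-additive a b additive-on-residues = begin
    ⌈ a / m ⌉ + ⌈ b / m ⌉
      ≡⟨ cong₂ _+_ (⌈n/m⌉≡n/m+⌈n%m/m⌉ a) (⌈n/m⌉≡n/m+⌈n%m/m⌉ b) ⟩
    (a / m + ⌈ a % m / m ⌉) + (b / m + ⌈ b % m / m ⌉)
      ≡⟨ interchange (a / m) _ (b / m) _ ⟩
    (a / m + b / m) + (⌈ a % m / m ⌉ + ⌈ b % m / m ⌉)
      ≡⟨ cong (a / m + b / m +_) additive-on-residues ⟩
    (a / m + b / m) + ⌈ a % m + b % m / m ⌉
      ≡⟨ sym (⌈r+q*m/m⌉≡q+⌈r/m⌉ (a % m + b % m) (a / m + b / m)) ⟩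
    ⌈ (a % m + b % m) + (a / m + b / m) * m / m ⌉
      ≡⟨ cong (λ x → ⌈ x / m ⌉) (trans (regroup (a % m) (b % m) (a / m) (b / m))
                                       (sym (cong₂ _+_ (m≡m%n+[m/n]*n a m) (m≡m%n+[m/n]*n b m)))) ⟩
    ⌈ a + b / m ⌉ ∎
    where
    open ≡-Reasoning
    regroup : ∀ r₁ r₂ q₁ q₂ → (r₁ + r₂) + (q₁ + q₂) * m ≡ (r₁ + q₁ * m) + (r₂ + q₂ * m)
    regroup r₁ r₂ q₁ q₂ = trans (cong ((r₁ + r₂) +_) (*-distribʳ-+ m q₁ q₂))
                                (interchange r₁ r₂ (q₁ * m) (q₂ * m))

  [m*q+r]%m≡r : ∀ q {r} → r < m → (m * q + r) % m ≡ r
  [m*q+r]%m≡r q {r} r<m = trans (%-remove-+ˡ r (m∣m*n q)) (m<n⇒m%n≡m r<m)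

↑ˡ≢↑ʳ : ∀ {k L} (x : Fin k) (j : Fin L) → x ↑ˡ L ≢ k ↑ʳ j
↑ˡ≢↑ʳ {k} {L} x j eq
  with trans (sym (splitAt-↑ˡ k x L)) (trans (cong (splitAt k) eq) (splitAt-↑ʳ k L j))
... | ()

module _ (m : ℕ) .{{_ : NonZero m}} {L : ℕ} (residueColour : ℕ → Maybe (Fin L)) where

  FreshSumFree : Set
  FreshSumFree = ∀ {r₁} → r₁ < m → ∀ {r₂} → r₂ < m → ∀ j →
    residueColour r₁ ≡ just j → residueColour r₂ ≡ just j → residueColour ((r₁ + r₂) % m) ≢ just j

  KeptAdditive : Set
  KeptAdditive = ∀ {r₁} → r₁ < m → ∀ {r₂} → r₂ < m →
    residueColour r₁ ≡ nothing → residueColour r₂ ≡ nothing → residueColour ((r₁ + r₂) % m) ≡ nothing →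
    ⌈ r₁ / m ⌉ + ⌈ r₂ / m ⌉ ≡ ⌈ r₁ + r₂ / m ⌉

  residueColour≟ : ∀ r μ → Dec (residueColour r ≡ μ)
  residueColour≟ r μ = ≡-dec _≟ᶠ_ (residueColour r) μ

  fresh? : ∀ r₁ r₂ → Dec (∀ j → residueColour r₁ ≡ just j → residueColour r₂ ≡ just j →
                                 residueColour ((r₁ + r₂) % m) ≢ just j)
  fresh? r₁ r₂ = all? λ j → residueColour≟ r₁ (just j) →-dec residueColour≟ r₂ (just j) →-dec
                            ¬? (residueColour≟ ((r₁ + r₂) % m) (just j))

  kept? : ∀ r₁ r₂ → Dec (residueColour r₁ ≡ nothing → residueColour r₂ ≡ nothing →
                          residueColour ((r₁ + r₂) % m) ≡ nothing →
                          ⌈ r₁ / m ⌉ + ⌈ r₂ / m ⌉ ≡ ⌈ r₁ + r₂ / m ⌉)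
  kept? r₁ r₂ = residueColour≟ r₁ nothing →-dec residueColour≟ r₂ nothing →-dec
                residueColour≟ ((r₁ + r₂) % m) nothing →-dec
                ⌈ r₁ / m ⌉ + ⌈ r₂ / m ⌉ ≟ ⌈ r₁ + r₂ / m ⌉

  LowFresh : ℕ → Set
  LowFresh e = ∀ {d} → d < e → residueColour (suc d) ≢ nothing

  lowFresh? : ∀ d → Dec (residueColour (suc d) ≢ nothing)
  lowFresh? d = ¬? (residueColour≟ (suc d) nothing)

-- residueColour r ≡ just j: the numbers ≡ r mod m get fresh colour j; nothing: they are kept.
record Template (m L e : ℕ) .{{_ : NonZero m}} : Set where
  field
    residueColour : ℕ → Maybe (Fin L)
    fresh-sumFree : FreshSumFree m residueColour
    kept-additive : KeptAdditive m residueColour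
    low-fresh     : LowFresh m residueColour e
    e<m           : e < m

module Inflation {m L e : ℕ} .{{_ : NonZero m}} (template : Template m L e) where
  open Template template

  fresh-sumFree-mod : ∀ a b j → residueColour (a % m) ≡ just j → residueColour (b % m) ≡ just j →
                      residueColour ((a + b) % m) ≢ just j
  fresh-sumFree-mod a b j ca cb =
    fresh-sumFree (m%n<n a m) (m%n<n b m) j ca cb ∘
    subst (λ r → residueColour r ≡ just j) (%-distribˡ-+ a b m)

  kept-additive-mod : ∀ a b → residueColour (a % m) ≡ nothing → residueColour (b % m) ≡ nothing →
                      residueColour ((a + b) % m) ≡ nothing → ⌈ a / m ⌉ + ⌈ b / m ⌉ ≡ ⌈ a + b / m ⌉
  kept-additive-mod a b ka kb kab = ⌈/⌉-additive m a b (kept-additive (m%n<n a m) (m%n<n b m) ka kb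
    (subst (λ r → residueColour r ≡ nothing) (%-distribˡ-+ a b m) kab))

  kept-below : ∀ {s} x → x ≤ m * s + e → residueColour (x % m) ≡ nothing → ⌈ x / m ⌉ ≤ s
  kept-below {s} x x≤ kept with x ≤? m * s
  ... | yes x≤ms = ⌈n/m⌉≤q m x≤ms
  ... | no x≰ms with x ∸ suc (m * s) | m+[n∸m]≡n (≰⇒> x≰ms)
  ... | d | refl = ⊥-elim (low-fresh d<e (subst (λ r → residueColour r ≡ nothing) residue kept))
    where
    x≡ : suc (m * s) + d ≡ m * s + suc d
    x≡ = sym (+-suc (m * s) d)
    d<e : d < e
    d<e = +-cancelˡ-≤ (m * s) (suc d) e (subst (_≤ m * s + e) x≡ x≤)
    residue : (suc (m * s) + d) % m ≡ suc d
    residue = trans (cong (_% m) x≡) ([m*q+r]%m≡r m s (≤-<-trans d<e e<m))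

  module _ {k : ℕ} (c : ℕ → Fin k) where

    colouring : ℕ → Fin (k + L)
    colouring x = maybe′ (k ↑ʳ_) (c ⌈ x / m ⌉ ↑ˡ L) (residueColour (x % m))

    data Coloured (x : ℕ) (i : Fin (k + L)) : Set where
      fresh : ∀ j → residueColour (x % m) ≡ just j → k ↑ʳ j ≡ i → Coloured x i
      kept  : residueColour (x % m) ≡ nothing → c ⌈ x / m ⌉ ↑ˡ L ≡ i → Coloured x i

    coloured : ∀ {x i} → colouring x ≡ i → Coloured x i
    coloured {x} refl with residueColour (x % m) in eq
    ... | just j  = fresh j eq refl
    ... | nothing = kept eq refl

    same-fresh : ∀ {i} {j j′ : Fin L} → k ↑ʳ j ≡ i → k ↑ʳ j′ ≡ i → j ≡ j′
    same-fresh e e′ = ↑ʳ-injective k _ _ (trans e (sym e′))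

    same-kept : ∀ {i x y} → c x ↑ˡ L ≡ i → c y ↑ˡ L ≡ i → c x ≡ c y
    same-kept e e′ = ↑ˡ-injective L _ _ (trans e (sym e′))

    sumFree : ∀ {s} → (∀ i → SumFreePart k s c i) → ∀ i → SumFreePart (k + L) (m * s + e) colouring i
    sumFree {s} sf i a b a>0 b>0 a+b≤ (ca , cb , cab)
      with coloured ca | coloured cb | coloured cab
    ... | fresh j₁ p₁ e₁ | fresh j₂ p₂ e₂ | fresh j₃ p₃ e₃ =
      fresh-sumFree-mod a b j₁ p₁ (trans p₂ (cong just (same-fresh e₂ e₁)))
                                  (trans p₃ (cong just (same-fresh e₃ e₁)))
    ... | kept p₁ e₁ | kept p₂ e₂ | kept p₃ e₃ =
      sf (c ⌈ a / m ⌉) ⌈ a / m ⌉ ⌈ b / m ⌉ (⌈n/m⌉>0 m a>0) (⌈n/m⌉>0 m b>0)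
         (subst (_≤ s) (sym additive) (kept-below (a + b) a+b≤ p₃))
         (refl , same-kept e₂ e₁ ,
          subst (λ y → c y ≡ c ⌈ a / m ⌉) (sym additive) (same-kept e₃ e₁))
      where additive = kept-additive-mod a b p₁ p₂ p₃
    ... | fresh _ _ e₁ | kept _ e₂     | _            = ↑ˡ≢↑ʳ _ _ (trans e₂ (sym e₁))
    ... | kept _ e₁    | fresh _ _ e₂  | _            = ↑ˡ≢↑ʳ _ _ (trans e₁ (sym e₂))
    ... | fresh _ _ e₁ | fresh _ _ _   | kept _ e₃    = ↑ˡ≢↑ʳ _ _ (trans e₃ (sym e₁))
    ... | kept _ e₁    | kept _ _      | fresh _ _ e₃ = ↑ˡ≢↑ʳ _ _ (trans e₁ (sym e₃))

  inflate : ∀ {k s} → SumFreePartitionable k s → SumFreePartitionable (k + L) (m * s + e)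
  inflate (c , sf) = colouring c , sumFree c sf

  schur-inflate : ∀ {k s t} → IsSchurNumber k s → IsSchurNumber (k + L) t → m * s + e ≤ t
  schur-inflate (partition , _) (_ , maximal) = maximal _ (inflate partition)

classOf : ∀ {L} → Vec (List ℕ) L → ℕ → Maybe (Fin L)
classOf []       r = nothing
classOf (A ∷ As) r = if any (r ≡ᵇ_) A then just zero else Maybe.map suc (classOf As r)

freshClasses₁₀₉ : Vec (List ℕ) 4
freshClasses₁₀₉ =
  (1 ∷ 4 ∷ 6 ∷ 13 ∷ 16 ∷ 24 ∷ 27 ∷ 34 ∷ 36 ∷ 41 ∷ 44 ∷ 46 ∷ 53 ∷ 96 ∷ 103 ∷ 105 ∷ 108 ∷ []) ∷
  (2 ∷ 5 ∷ 12 ∷ 15 ∷ 18 ∷ 22 ∷ 25 ∷ 28 ∷ 32 ∷ 35 ∷ 38 ∷ 39 ∷ 49 ∷ 59 ∷ 69 ∷ 80 ∷ 90 ∷ 100 ∷ []) ∷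
  (3 ∷ 7 ∷ 8 ∷ 9 ∷ 19 ∷ 20 ∷ 21 ∷ 31 ∷ 33 ∷ 37 ∷ 43 ∷ 47 ∷ 102 ∷ 106 ∷ []) ∷
  (10 ∷ 11 ∷ 14 ∷ 17 ∷ 23 ∷ 26 ∷ 29 ∷ 30 ∷ 42 ∷ 45 ∷ 48 ∷ 51 ∷ 54 ∷ 57 ∷ 92 ∷ 95 ∷ 98 ∷ 101 ∷ 104 ∷ 107 ∷ []) ∷
  []

template₁₀₉ : Template 109 4 39
template₁₀₉ = record
  { residueColour = colour
  ; fresh-sumFree = allBelow²-decide (fresh? 109 colour) 109 refl
  ; kept-additive = allBelow²-decide (kept? 109 colour) 109 refl
  ; low-fresh     = allBelow-decide (lowFresh? 109 colour) 39 refl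
  ; e<m           = toWitness {a? = 39 <? 109} tt
  }
  where colour = classOf freshClasses₁₀₉

mainTheorem4 : ∀ (k s t : ℕ) → 1 ≤ k → IsSchurNumber k s →
                 IsSchurNumber (k + 4) t → 109 * s + 39 ≤ t
mainTheorem4 k s t _ = Inflation.schur-inflate template₁₀₉
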